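{- Let $I_{age}$ be an instance of the Min-Age problem and $I_{job}$ its corresponding Min-WCS instance. Let $S_{age}$ be a map from $\mathcal{M}_1\cup\cdots\cup\mathcal{M}_n$ to the integers and $S_{job}$ a map from the jobs of $I_{job}$ to the integers such that $S_{age}(M_i^j) = S_{job}(J_i^j) + T_0$ for all $1 \leq i \leq n$, $1 \leq j \leq |\mathcal{C}_i|$. Then (1) $S_{age}$ is a feasible schedule of $I_{age}$ if and only if $S_{job}$ is a feasible schedule of $I_{job}$; and (2) $2\,Age(S_{age}) = wcs(S_{job})$.
   Context: Min-Age problem. Input: a positive integer $n$, an integer $T_0 \geq 0$, and for each $i$ a positive integer $m_i$ and messages $M_i^0, \dots, M_i^{m_i}$ with integer birthdays with $0 \leq b(M_i^0) < b(M_i^1) < \cdots < b(M_i^{m_i}) \leq T_0$. Let $\mathcal{M}_i = \{M_i^1,\dots,M_i^{m_i}\}$ and $T = \sum_i m_i$. A feasible schedule $S$ is a bijection from $\bigcup_i\mathcal{M}_i$ to $\{T_0+1,\dots,T_0+T\}$ with $S(M_i^1) < \cdots < S(M_i^{m_i})$ for every $i$. For an integer $t$, $lm(S,i,t)$ is $M_i^j$ with $j$ the largest index in $\{0,\dots,m_i\}$ with $j=0$ or $S(M_i^j)\leq t$; $age(S,i,t) = t - b(lm(S,i,t))$ if $lm(S,i,t) \neq M_i^{m_i}$ and $0$ otherwise; $Age(S) = \sum_{i=1}^n \sum_{t=T_0}^{T_0+T} age(S,i,t)$. Min-WCS problem. Input: job chains $\mathcal{C}_1,\dots,\mathcal{C}_n$,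 $\mathcal{C}_i$ consisting of jobs $J_i^1 \to \cdots \to J_i^{|\mathcal{C}_i|}$ with non-negative weights $w_i^j$; with $T=\sum_i|\mathcal{C}_i|$, a feasible schedule $S$ is a bijection from all jobs to $\{1,\dots,T\}$ with $S(J_i^1)<\cdots<S(J_i^{|\mathcal{C}_i|})$ for all $i$; $wcs(S)=\sum_{i,j} w_i^j S(J_i^j)+\sum_{i} S(J_i^{|\mathcal{C}_i|})^2$. Corresponding instance: given $I_{age}$, $I_{job}$ has $n$ chains with $|\mathcal{C}_i| = m_i$, weights $w_i^j = 2(b(M_i^j) - b(M_i^{j-1}))$ for $1\leq j\leq |\mathcal{C}_i|-1$, and $w_i^{|\mathcal{C}_i|} = 2(T_0 - \tfrac12 - b(M_i^{m_i-1}))$. -}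

module Defs where

open import Data.Nat as ℕ using (ℕ; zero; suc)
open import Data.Fin using (Fin; zero; suc; toℕ; fromℕ; inject₁)
open import Data.Integer as ℤ using (ℤ; +_; _+_; _-_; _*_; _≤_; _<_; _≤?_)
open import Data.Product using (Σ; Σ-syntax; _×_; _,_; ∃; ∃-syntax)
open import Relation.Nullary using (yes; no)
open import Relation.Binary.PropositionalEquality using (_≡_)
open import Function using (_∘_)

sumFin : ∀ {k} → (Fin k → ℤ) → ℤ
sumFin {zero}  f = + 0
sumFin {suc k} f = f zero + sumFin (f ∘ suc)

sumFinℕ : ∀ {k} → (Fin k → ℕ) → ℕ
sumFinℕ {zero}  f = 0
sumFinℕ {suc k} f = f zero ℕ.+ sumFinℕ (f ∘ suc)

-- sumFromTo a c f = Σ_{t = a}^{a + c} f t   (c + 1 terms)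
sumFromTo : ℤ → ℕ → (ℤ → ℤ) → ℤ
sumFromTo a zero    f = f a
sumFromTo a (suc c) f = f a + sumFromTo (a + + 1) c f

-- Message M_i^j (0 ≤ j ≤ m_i) has birthday  b i j  with j : Fin (suc (m i)).
-- The schedulable messages  M_i^1 … M_i^{m_i}  are indexed by
-- (i , j) with j : Fin (m i), standing for M_i^{toℕ j + 1}.

record AgeInstance : Set where
  field
    n     : ℕ
    T0    : ℕ
    m     : Fin n → ℕ
    m-pos : ∀ i → 1 ℕ.≤ m i
    b     : (i : Fin n) → Fin (suc (m i)) → ℕ
    b-inc : ∀ i (j k : Fin (suc (m i))) → toℕ k ≡ suc (toℕ j) → b i j ℕ.< b i k
    b-le  : ∀ i → b i (fromℕ (m i)) ℕ.≤ T0

module _ (I : AgeInstance) where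
  open AgeInstance I

  Msg : Set
  Msg = Σ[ i ∈ Fin n ] Fin (m i)

  Tage : ℕ
  Tage = sumFinℕ m

  FeasibleAge : (Msg → ℤ) → Set
  FeasibleAge S =
      (∀ x → (+ T0 + + 1 ≤ S x) × (S x ≤ + T0 + + Tage))
    × (∀ x y → S x ≡ S y → x ≡ y)
    × (∀ t → + T0 + + 1 ≤ t → t ≤ + T0 + + Tage → ∃[ x ] S x ≡ t)
    × (∀ i (j k : Fin (m i)) → toℕ k ≡ suc (toℕ j) → S (i , j) < S (i , k))

-- lastLe k f t : the largest j ∈ {0,…,k} with j = 0 or f (j-1) ≤ t,
-- where f (j-1) is the value at message index j (indices shifted by one).
lastLe : (k : ℕ) → (Fin k → ℤ) → ℤ → Fin (suc k)
lastLe zero    f t = zero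
lastLe (suc k) f t with f (fromℕ k) ≤? t
... | yes _ = fromℕ (suc k)
... | no  _ = inject₁ (lastLe k (f ∘ inject₁) t)

module _ (I : AgeInstance) where
  open AgeInstance I

  -- index j of lm(S,i,t) = M_i^j
  lm : (Msg I → ℤ) → (i : Fin n) → ℤ → Fin (suc (m i))
  lm S i t = lastLe (m i) (λ j → S (i , j)) t

  age : (Msg I → ℤ) → (i : Fin n) → ℤ → ℤ
  age S i t with toℕ (lm S i t) ℕ.≟ m i
  ... | yes _ = + 0
  ... | no  _ = t - + (b i (lm S i t))

  Age : (Msg I → ℤ) → ℤ
  Age S = sumFin (λ i → sumFromTo (+ T0) (Tage I) (age S i))

-- Min-WCS instances.  Chain i has  len i  jobs; job (i , j) with
-- j : Fin (len i) is J_i^{toℕ j + 1}, with weight  w i j.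

record JobInstance : Set where
  field
    n   : ℕ
    len : Fin n → ℕ
    w   : (i : Fin n) → Fin (len i) → ℤ

lastSq : (k : ℕ) → (Fin k → ℤ) → ℤ
lastSq zero    f = + 0
lastSq (suc k) f = f (fromℕ k) * f (fromℕ k)

module _ (J : JobInstance) where
  open JobInstance J

  Job : Set
  Job = Σ[ i ∈ Fin n ] Fin (len i)

  Tjob : ℕ
  Tjob = sumFinℕ len

  FeasibleJob : (Job → ℤ) → Set
  FeasibleJob S =
      (∀ x → (+ 1 ≤ S x) × (S x ≤ + Tjob))
    × (∀ x y → S x ≡ S y → x ≡ y)
    × (∀ t → + 1 ≤ t → t ≤ + Tjob → ∃[ x ] S x ≡ t)
    × (∀ i (j k : Fin (len i)) → toℕ k ≡ suc (toℕ j) → S (i , j) < S (i , k))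

  wcs : (Job → ℤ) → ℤ
  wcs S = sumFin (λ i → sumFin (λ j → w i j * S (i , j)))
        + sumFin (λ i → lastSq (len i) (λ j → S (i , j)))

-- For job index j (i.e. J_i^{j'} with j' = toℕ j + 1):
--   if j' < m_i :  w = 2 (b(M_i^{j'}) - b(M_i^{j'-1}))
--   if j' = m_i :  w = 2 (T0 - 1/2 - b(M_i^{m_i - 1})) = 2 T0 - 1 - 2 b(M_i^{m_i-1})

corrWeight : (I : AgeInstance) → (i : Fin (AgeInstance.n I))
           → Fin (AgeInstance.m I i) → ℤ
corrWeight I i j with suc (toℕ j) ℕ.<? m i
  where open AgeInstance I
... | yes _ = + 2 * (+ b i (suc j) - + b i (inject₁ j))
  where open AgeInstance I
... | no  _ = + 2 * + T0 - + 1 - + 2 * + b i (inject₁ j)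
  where open AgeInstance I

corr : AgeInstance → JobInstance
corr I = record
  { n   = AgeInstance.n I
  ; len = AgeInstance.m I
  ; w   = corrWeight I
  }

-- Shifting by T0 maps the slots T0+1 … T0+T order-preservingly onto 1 … T, so feasibility
-- transfers.  For the cost, fix a chain with job times s_j and birthdays b_j, and let a = T0.
-- Until the last message is sent (at time a + s_m) the age at time t is t minus the birthday
-- of the last delivered message, and afterwards it is 0.  Summing t over a … a + s_m - 1
-- gives s_m (2a + s_m - 1) / 2, and summing the birthdays by parts gives
-- s_m b_{m-1} - Σ_j (b_j - b_{j-1}) s_j; twice the difference is Σ_j w_j s_j + s_m², the
-- chain's contribution to wcs.
module Submission where

open import Defs
open import Data.Nat as ℕ using (ℕ; zero; suc)
open import Data.Fin using (Fin; zero; suc; toℕ; fromℕ; inject₁)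
import Data.Fin.Properties as Fin
import Data.Nat.Properties as ℕ
open import Data.Integer using (ℤ; +_; +<+; +≤+; _+_; _-_; _*_; -_; _≤_; _<_; _≤?_; ∣_∣)
import Data.Integer.Properties as ℤ
open import Data.Integer.Tactic.RingSolver using (solve-∀)
open import Data.Product using (_×_; _,_; ∃₂; ∃-syntax; proj₁; proj₂)
open import Data.Empty using (⊥-elim)
open import Function using (_∘_)
open import Function.Bundles using (_⇔_; mk⇔)
open import Relation.Nullary using (yes; no)
open import Relation.Binary.PropositionalEquality
  using (_≡_; refl; sym; trans; cong; cong₂; subst; subst₂; module ≡-Reasoning)

i+j-j≡i : ∀ i j → i + j - j ≡ i
i+j-j≡i = solve-∀

i-j+j≡i : ∀ i j → i - j + j ≡ i
i-j+j≡i = solve-∀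

i+j-i≡j : ∀ i j → i + j - i ≡ j
i+j-i≡j = solve-∀

i+[j-i]≡j : ∀ i j → i + (j - i) ≡ j
i+[j-i]≡j = solve-∀

+-cancelʳ-≡ : ∀ c {x y} → x + c ≡ y + c → x ≡ y
+-cancelʳ-≡ c {x} {y} eq =
  trans (sym (i+j-j≡i x c)) (trans (cong (_- c) eq) (i+j-j≡i y c))

-- FeasibleAge and FeasibleJob are both definitionally instances of this.
Feasible : {X : Set} → ((X → ℤ) → Set) → ℤ → ℤ → (X → ℤ) → Set
Feasible P lo hi S =
    (∀ x → (lo ≤ S x) × (S x ≤ hi))
  × (∀ x y → S x ≡ S y → x ≡ y)
  × (∀ t → lo ≤ t → t ≤ hi → ∃[ x ] S x ≡ t)
  × P S

Feasible-shift : ∀ {X : Set} {P : (X → ℤ) → Set} {lo hi lo′ hi′} c {S S′ : X → ℤ}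
  → (∀ x → S′ x ≡ S x + c) → lo′ ≡ lo + c → hi′ ≡ hi + c → (P S → P S′)
  → Feasible P lo hi S → Feasible P lo′ hi′ S′
Feasible-shift {lo = lo} {hi} c {S} {S′} S′≡ refl refl P⇒P′
               (bounds , injective , surjective , prec) =
  bounds′ , injective′ , surjective′ , P⇒P′ prec
  where
  bounds′ : ∀ x → (lo + c ≤ S′ x) × (S′ x ≤ hi + c)
  bounds′ x = subst (lo + c ≤_) (sym (S′≡ x)) (ℤ.+-monoˡ-≤ c (proj₁ (bounds x)))
            , subst (_≤ hi + c) (sym (S′≡ x)) (ℤ.+-monoˡ-≤ c (proj₂ (bounds x)))
  injective′ : ∀ x y → S′ x ≡ S′ y → x ≡ y
  injective′ x y eq = injective x y (+-cancelʳ-≡ c (trans (sym (S′≡ x)) (trans eq (S′≡ y))))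
  surjective′ : ∀ t → lo + c ≤ t → t ≤ hi + c → ∃[ x ] S′ x ≡ t
  surjective′ t lo≤t t≤hi
    with surjective (t - c) (subst (_≤ t - c) (i+j-j≡i lo c) (ℤ.+-monoˡ-≤ (- c) lo≤t))
                            (subst (t - c ≤_) (i+j-j≡i hi c) (ℤ.+-monoˡ-≤ (- c) t≤hi))
  ... | x , Sx≡ = x , trans (S′≡ x) (trans (cong (_+ c) Sx≡) (i-j+j≡i t c))

sumFin-cong : ∀ {k} {f g : Fin k → ℤ} → (∀ j → f j ≡ g j) → sumFin f ≡ sumFin g
sumFin-cong {zero}  f≗g = refl
sumFin-cong {suc k} f≗g = cong₂ _+_ (f≗g zero) (sumFin-cong (f≗g ∘ suc))

sumFin-distrib-+ : ∀ {k} (f g : Fin k → ℤ) → sumFin (λ j → f j + g j) ≡ sumFin f + sumFin g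
sumFin-distrib-+ {zero}  f g = refl
sumFin-distrib-+ {suc k} f g =
  trans (cong (_+_ (f zero + g zero)) (sumFin-distrib-+ (f ∘ suc) (g ∘ suc)))
        (interchange (f zero) (g zero) _ _)
  where
  interchange : ∀ a b c d → a + b + (c + d) ≡ a + c + (b + d)
  interchange = solve-∀

*-distribˡ-sumFin : ∀ {k} c (f : Fin k → ℤ) → c * sumFin f ≡ sumFin (λ j → c * f j)
*-distribˡ-sumFin {zero}  c f = ℤ.*-zeroʳ c
*-distribˡ-sumFin {suc k} c f =
  trans (ℤ.*-distribˡ-+ c (f zero) _) (cong (_+_ (c * f zero)) (*-distribˡ-sumFin c (f ∘ suc)))

sumFin-init-last : ∀ k (f : Fin (suc k) → ℤ) → sumFin f ≡ sumFin (f ∘ inject₁) + f (fromℕ k)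
sumFin-init-last zero    f = ℤ.+-comm (f zero) (+ 0)
sumFin-init-last (suc k) f =
  trans (cong (_+_ (f zero)) (sumFin-init-last k (f ∘ suc))) (sym (ℤ.+-assoc (f zero) _ _))

lastSq-cong : ∀ k {f g : Fin k → ℤ} → (∀ j → f j ≡ g j) → lastSq k f ≡ lastSq k g
lastSq-cong zero    f≗g = refl
lastSq-cong (suc k) f≗g = cong₂ _*_ (f≗g (fromℕ k)) (f≗g (fromℕ k))

sumFromTo-cong : ∀ a c {g h : ℤ → ℤ} → (∀ t → g t ≡ h t) → sumFromTo a c g ≡ sumFromTo a c h
sumFromTo-cong a zero    g≗h = g≗h a
sumFromTo-cong a (suc c) g≗h = cong₂ _+_ (g≗h a) (sumFromTo-cong (a + + 1) c g≗h)

-- sumRange a n g sums g over a … a + n - 1 (n terms, unlike sumFromTo).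
sumRange : ℤ → ℕ → (ℤ → ℤ) → ℤ
sumRange a zero    g = + 0
sumRange a (suc n) g = g a + sumRange (a + + 1) n g

sumFromTo≡sumRange : ∀ a c g → sumFromTo a c g ≡ sumRange a (suc c) g
sumFromTo≡sumRange a zero    g = sym (ℤ.+-identityʳ (g a))
sumFromTo≡sumRange a (suc c) g = cong (_+_ (g a)) (sumFromTo≡sumRange (a + + 1) c g)

a+1+n≡a+[1+n] : ∀ a n → a + + 1 + + n ≡ a + + suc n
a+1+n≡a+[1+n] a n = trans (ℤ.+-assoc a (+ 1) (+ n)) (cong (_+_ a) (sym (ℤ.pos-+ 1 n)))

sumRange-++ : ∀ a n₁ n₂ g → sumRange a (n₁ ℕ.+ n₂) g ≡ sumRange a n₁ g + sumRange (a + + n₁) n₂ g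
sumRange-++ a zero     n₂ g =
  sym (trans (ℤ.+-identityˡ _) (cong (λ b → sumRange b n₂ g) (ℤ.+-identityʳ a)))
sumRange-++ a (suc n₁) n₂ g = begin
  g a + sumRange (a + + 1) (n₁ ℕ.+ n₂) g
    ≡⟨ cong (_+_ (g a)) (sumRange-++ (a + + 1) n₁ n₂ g) ⟩
  g a + (sumRange (a + + 1) n₁ g + sumRange (a + + 1 + + n₁) n₂ g)
    ≡⟨ cong (λ b → g a + (sumRange (a + + 1) n₁ g + sumRange b n₂ g)) (a+1+n≡a+[1+n] a n₁) ⟩
  g a + (sumRange (a + + 1) n₁ g + sumRange (a + + suc n₁) n₂ g)
    ≡⟨ sym (ℤ.+-assoc (g a) _ _) ⟩
  g a + sumRange (a + + 1) n₁ g + sumRange (a + + suc n₁) n₂ g ∎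
  where open ≡-Reasoning

sumRange-cong : ∀ a n {g h : ℤ → ℤ} → (∀ t → a ≤ t → t < a + + n → g t ≡ h t)
  → sumRange a n g ≡ sumRange a n h
sumRange-cong a zero    g≗h = refl
sumRange-cong a (suc n) g≗h =
  cong₂ _+_ (g≗h a ℤ.≤-refl a<a+[1+n])
            (sumRange-cong (a + + 1) n λ t a+1≤t t<a+1+n →
               g≗h t (ℤ.≤-trans (ℤ.i≤i+j a (+ 1)) a+1≤t)
                     (subst (t <_) (a+1+n≡a+[1+n] a n) t<a+1+n))
  where
  a<a+[1+n] : a < a + + suc n
  a<a+[1+n] = subst (_< a + + suc n) (ℤ.+-identityʳ a) (ℤ.+-monoʳ-< a (+<+ (ℕ.s≤s ℕ.z≤n)))

sumRange-const : ∀ a n c → sumRange a n (λ _ → c) ≡ + n * c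
sumRange-const a zero    c = refl
sumRange-const a (suc n) c =
  trans (cong (_+_ c) (sumRange-const (a + + 1) n c)) (sym (ℤ.suc-* (+ n) c))

sumRange-distrib-- : ∀ a n (g h : ℤ → ℤ)
  → sumRange a n (λ t → g t - h t) ≡ sumRange a n g - sumRange a n h
sumRange-distrib-- a zero    g h = refl
sumRange-distrib-- a (suc n) g h =
  trans (cong (_+_ (g a - h a)) (sumRange-distrib-- (a + + 1) n g h)) (interchange (g a) (h a) _ _)
  where
  interchange : ∀ x y u v → x - y + (u - v) ≡ x + u - (y + v)
  interchange = solve-∀

sumRange-id : ∀ a n → + 2 * sumRange a n (λ t → t) ≡ + n * (+ 2 * a + + n - + 1)
sumRange-id a zero    = ℤ.*-zeroʳ (+ 2)
sumRange-id a (suc n) = begin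
  + 2 * (a + sumRange (a + + 1) n (λ t → t))
    ≡⟨ ℤ.*-distribˡ-+ (+ 2) a _ ⟩
  + 2 * a + + 2 * sumRange (a + + 1) n (λ t → t)
    ≡⟨ cong (_+_ (+ 2 * a)) (sumRange-id (a + + 1) n) ⟩
  + 2 * a + + n * (+ 2 * (a + + 1) + + n - + 1)
    ≡⟨ step a (+ n) ⟩
  (+ 1 + + n) * (+ 2 * a + (+ 1 + + n) - + 1)
    ≡⟨ cong (λ m → m * (+ 2 * a + m - + 1)) (sym (ℤ.pos-+ 1 n)) ⟩
  + suc n * (+ 2 * a + + suc n - + 1) ∎
  where
  open ≡-Reasoning
  step : ∀ a n → + 2 * a + n * (+ 2 * (a + + 1) + n - + 1)
                 ≡ (+ 1 + n) * (+ 2 * a + (+ 1 + n) - + 1)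
  step = solve-∀

Increasing : ∀ {k} → (Fin k → ℤ) → Set
Increasing {k} f = ∀ (j j′ : Fin k) → toℕ j′ ≡ suc (toℕ j) → f j < f j′

Increasing-suc : ∀ {k} {f : Fin (suc k) → ℤ} → Increasing f → Increasing (f ∘ suc)
Increasing-suc inc j j′ eq = inc (suc j) (suc j′) (cong suc eq)

Increasing-inject₁ : ∀ {k} {f : Fin (suc k) → ℤ} → Increasing f → Increasing (f ∘ inject₁)
Increasing-inject₁ inc j j′ eq = inc (inject₁ j) (inject₁ j′)
  (trans (Fin.toℕ-inject₁ j′) (trans eq (cong suc (sym (Fin.toℕ-inject₁ j)))))

Increasing-shift : ∀ {k} c {f g : Fin k → ℤ} → (∀ j → g j ≡ f j + c) → Increasing f → Increasing g
Increasing-shift c g≡ inc j j′ eq =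
  subst₂ _<_ (sym (g≡ j)) (sym (g≡ j′)) (ℤ.+-monoˡ-< c (inc j j′ eq))

Increasing⇒≤last : ∀ k {f : Fin (suc k) → ℤ} → Increasing f → ∀ j → f j ≤ f (fromℕ k)
Increasing⇒≤last zero    inc zero    = ℤ.≤-refl
Increasing⇒≤last (suc k) inc zero    =
  ℤ.<⇒≤ (ℤ.<-≤-trans (inc zero (suc zero) refl) (Increasing⇒≤last k (Increasing-suc inc) zero))
Increasing⇒≤last (suc k) inc (suc j) = Increasing⇒≤last k (Increasing-suc inc) j

Increasing⇒init≤last : ∀ k {f : Fin (suc k) → ℤ} {x} → Increasing f → f (fromℕ k) ≡ x
  → ∀ j → f (inject₁ j) ≤ x
Increasing⇒init≤last k inc refl j = Increasing⇒≤last k inc (inject₁ j)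

lastLe-≥ : ∀ k (f : Fin (suc k) → ℤ) {t} → f (fromℕ k) ≤ t → lastLe (suc k) f t ≡ fromℕ (suc k)
lastLe-≥ k f {t} last≤t with f (fromℕ k) ≤? t
... | yes _      = refl
... | no  last≰t = ⊥-elim (last≰t last≤t)

lastLe-< : ∀ k (f : Fin (suc k) → ℤ) {t} → t < f (fromℕ k)
  → lastLe (suc k) f t ≡ inject₁ (lastLe k (f ∘ inject₁) t)
lastLe-< k f {t} t<last with f (fromℕ k) ≤? t
... | yes last≤t = ⊥-elim (ℤ.<⇒≱ t<last last≤t)
... | no  _      = refl

a≤x≤a+N⇒split : ∀ {a x} N → a ≤ x → x ≤ a + + N → ∃₂ λ n n′ → (x ≡ a + + n) × (N ≡ n ℕ.+ n′)
a≤x≤a+N⇒split {a} {x} N a≤x x≤a+N = n , proj₁ n+n′≡N , x≡a+n , sym (proj₂ n+n′≡N)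
  where
  n : ℕ
  n = ∣ x - a ∣
  x-a≡n : x - a ≡ + n
  x-a≡n = sym (ℤ.0≤i⇒+∣i∣≡i (ℤ.i≤j⇒0≤j-i a≤x))
  x≡a+n : x ≡ a + + n
  x≡a+n = trans (sym (i+[j-i]≡j a x)) (cong (_+_ a) x-a≡n)
  n≤N : n ℕ.≤ N
  n≤N = ℤ.drop‿+≤+ (subst₂ _≤_ (trans (cong (_- a) x≡a+n) (i+j-i≡j a (+ n)))
                                (i+j-i≡j a (+ N))
                                (ℤ.+-monoˡ-≤ (- a) x≤a+N))
  n+n′≡N : ∃[ n′ ] n ℕ.+ n′ ≡ N
  n+n′≡N = ℕ.m≤n⇒∃[o]m+o≡n n≤N

-- Summation by parts: lastLe k f t is constant between consecutive values of f.
sumRange-lastLe : ∀ a N k (f : Fin k → ℤ) (B : Fin (suc k) → ℤ)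
  → Increasing f → (∀ j → a ≤ f j) → (∀ j → f j ≤ a + + N)
  → sumRange a N (λ t → B (lastLe k f t))
    ≡ + N * B (fromℕ k) - sumFin (λ j → (B (suc j) - B (inject₁ j)) * (f j - a))
sumRange-lastLe a N zero    f B inc lo hi =
  trans (sumRange-const a N (B zero)) (sym (ℤ.+-identityʳ _))
sumRange-lastLe a N (suc k) f B inc lo hi with a≤x≤a+N⇒split N (lo (fromℕ k)) (hi (fromℕ k))
... | n₁ , n₂ , F≡a+n₁ , refl = begin
  sumRange a (n₁ ℕ.+ n₂) (λ t → B (lastLe (suc k) f t))
    ≡⟨ sumRange-++ a n₁ n₂ _ ⟩
  sumRange a n₁ (λ t → B (lastLe (suc k) f t))
    + sumRange (a + + n₁) n₂ (λ t → B (lastLe (suc k) f t))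
    ≡⟨ cong₂ _+_ before after ⟩
  (+ n₁ * Bₖ - X) + + n₂ * B (fromℕ (suc k))
    ≡⟨ rearrange (+ n₁) (+ n₂) Bₖ (B (fromℕ (suc k))) X ⟩
  (+ n₁ + + n₂) * B (fromℕ (suc k)) - (X + (B (fromℕ (suc k)) - Bₖ) * + n₁)
    ≡⟨ cong₂ (λ N d → N * B (fromℕ (suc k)) - (X + (B (fromℕ (suc k)) - Bₖ) * d))
             (sym (ℤ.pos-+ n₁ n₂)) (sym F-a≡n₁) ⟩
  + (n₁ ℕ.+ n₂) * B (fromℕ (suc k)) - (X + (B (fromℕ (suc k)) - Bₖ) * (f (fromℕ k) - a))
    ≡⟨ cong (λ s → + (n₁ ℕ.+ n₂) * B (fromℕ (suc k)) - s)
            (sym (sumFin-init-last k (λ j → (B (suc j) - B (inject₁ j)) * (f j - a)))) ⟩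
  + (n₁ ℕ.+ n₂) * B (fromℕ (suc k)) - sumFin (λ j → (B (suc j) - B (inject₁ j)) * (f j - a)) ∎
  where
  open ≡-Reasoning
  Bₖ X : ℤ
  Bₖ = B (inject₁ (fromℕ k))
  X = sumFin (λ j → (B (suc (inject₁ j)) - B (inject₁ (inject₁ j))) * (f (inject₁ j) - a))
  F-a≡n₁ : f (fromℕ k) - a ≡ + n₁
  F-a≡n₁ = trans (cong (_- a) F≡a+n₁) (i+j-i≡j a (+ n₁))
  rearrange : ∀ n₁ n₂ Bₖ B X → (n₁ * Bₖ - X) + n₂ * B ≡ (n₁ + n₂) * B - (X + (B - Bₖ) * n₁)
  rearrange = solve-∀
  before : sumRange a n₁ (λ t → B (lastLe (suc k) f t)) ≡ + n₁ * Bₖ - X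
  before = trans (sumRange-cong a n₁ λ t _ t<a+n₁ →
                    cong B (lastLe-< k f (subst (t <_) (sym F≡a+n₁) t<a+n₁)))
                 (sumRange-lastLe a n₁ k (f ∘ inject₁) (B ∘ inject₁)
                    (Increasing-inject₁ inc) (lo ∘ inject₁) (Increasing⇒init≤last k inc F≡a+n₁))
  after : sumRange (a + + n₁) n₂ (λ t → B (lastLe (suc k) f t)) ≡ + n₂ * B (fromℕ (suc k))
  after = trans (sumRange-cong (a + + n₁) n₂ λ t a+n₁≤t _ →
                   cong B (lastLe-≥ k f (subst (_≤ t) (sym F≡a+n₁) a+n₁≤t)))
                (sumRange-const (a + + n₁) n₂ _)

chainAge : (m : ℕ) → (Fin (suc m) → ℤ) → (Fin m → ℤ) → ℤ → ℤ
chainAge m B f t with toℕ (lastLe m f t) ℕ.≟ m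
... | yes _ = + 0
... | no  _ = t - B (lastLe m f t)

chainWeight : ℤ → (m : ℕ) → (Fin (suc m) → ℤ) → Fin m → ℤ
chainWeight a m B j with suc (toℕ j) ℕ.<? m
... | yes _ = + 2 * (B (suc j) - B (inject₁ j))
... | no  _ = + 2 * a - + 1 - + 2 * B (inject₁ j)

chainAge-≥ : ∀ k B (f : Fin (suc k) → ℤ) {t} → f (fromℕ k) ≤ t → chainAge (suc k) B f t ≡ + 0
chainAge-≥ k B f {t} last≤t with toℕ (lastLe (suc k) f t) ℕ.≟ suc k
... | yes _  = refl
... | no  ≢k = ⊥-elim (≢k (trans (cong toℕ (lastLe-≥ k f last≤t)) (Fin.toℕ-fromℕ (suc k))))

chainAge-< : ∀ k B (f : Fin (suc k) → ℤ) {t} → t < f (fromℕ k)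
  → chainAge (suc k) B f t ≡ t - B (inject₁ (lastLe k (f ∘ inject₁) t))
chainAge-< k B f {t} t<last with toℕ (lastLe (suc k) f t) ℕ.≟ suc k
... | yes ≡k = ⊥-elim (Fin.toℕ-inject₁-≢ (lastLe k (f ∘ inject₁) t)
                                          (sym (trans (cong toℕ (sym (lastLe-< k f t<last))) ≡k)))
... | no  _  = cong (λ i → t - B i) (lastLe-< k f t<last)

chainWeight-inject₁ : ∀ a k B (j : Fin k)
  → chainWeight a (suc k) B (inject₁ j) ≡ + 2 * (B (suc (inject₁ j)) - B (inject₁ (inject₁ j)))
chainWeight-inject₁ a k B j with suc (toℕ (inject₁ j)) ℕ.<? suc k
... | yes _ = refl
... | no  ≮ = ⊥-elim (≮ (ℕ.s≤s (subst (ℕ._< k) (sym (Fin.toℕ-inject₁ j)) (Fin.toℕ<n j))))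

chainWeight-last : ∀ a k B
  → chainWeight a (suc k) B (fromℕ k) ≡ + 2 * a - + 1 - + 2 * B (inject₁ (fromℕ k))
chainWeight-last a k B with suc (toℕ (fromℕ k)) ℕ.<? suc k
... | yes < = ⊥-elim (ℕ.<-irrefl (cong suc (Fin.toℕ-fromℕ k)) <)
... | no  _ = refl

sumFin-chainWeight : ∀ a k B (g : Fin (suc k) → ℤ)
  → sumFin (λ j → chainWeight a (suc k) B j * g j)
    ≡ + 2 * sumFin (λ j → (B (suc (inject₁ j)) - B (inject₁ (inject₁ j))) * g (inject₁ j))
      + (+ 2 * a - + 1 - + 2 * B (inject₁ (fromℕ k))) * g (fromℕ k)
sumFin-chainWeight a k B g =
  trans (sumFin-init-last k (λ j → chainWeight a (suc k) B j * g j))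
        (cong₂ _+_ (trans (sumFin-cong weight-inject₁)
                          (sym (*-distribˡ-sumFin (+ 2) (λ j → Δ j * g (inject₁ j)))))
                   (cong (_* g (fromℕ k)) (chainWeight-last a k B)))
  where
  Δ : Fin k → ℤ
  Δ j = B (suc (inject₁ j)) - B (inject₁ (inject₁ j))
  weight-inject₁ : ∀ j
    → chainWeight a (suc k) B (inject₁ j) * g (inject₁ j) ≡ + 2 * (Δ j * g (inject₁ j))
  weight-inject₁ j = trans (cong (_* g (inject₁ j)) (chainWeight-inject₁ a k B j))
                           (ℤ.*-assoc (+ 2) (Δ j) (g (inject₁ j)))

sumFromTo-chainAge : ∀ a T m (B : Fin (suc m) → ℤ) (f : Fin m → ℤ)
  → Increasing f → (∀ j → a ≤ f j) → (∀ j → f j ≤ a + + T)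
  → + 2 * sumFromTo a T (chainAge m B f)
    ≡ sumFin (λ j → chainWeight a m B j * (f j - a)) + lastSq m (λ j → f j - a)
sumFromTo-chainAge a T zero B f inc lo hi =
  cong (+ 2 *_) (trans (sumFromTo≡sumRange a T _)
                       (trans (sumRange-const a (suc T) (+ 0)) (ℤ.*-zeroʳ (+ suc T))))
sumFromTo-chainAge a T (suc k) B f inc lo hi
  with a≤x≤a+N⇒split (suc T) (lo (fromℕ k))
                     (ℤ.≤-trans (hi (fromℕ k)) (ℤ.+-monoʳ-≤ a (+≤+ (ℕ.n≤1+n T))))
... | n₁ , n₂ , F≡a+n₁ , 1+T≡n₁+n₂ = begin
  + 2 * sumFromTo a T A
    ≡⟨ cong (+ 2 *_) (trans (sumFromTo≡sumRange a T A)
                            (trans (cong (λ N → sumRange a N A) 1+T≡n₁+n₂) (sumRange-++ a n₁ n₂ A))) ⟩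
  + 2 * (sumRange a n₁ A + sumRange (a + + n₁) n₂ A)
    ≡⟨ cong (+ 2 *_) (cong₂ _+_ before after) ⟩
  + 2 * ((R - (+ n₁ * Bₖ - X)) + + 0)
    ≡⟨ expand R X (+ n₁) Bₖ ⟩
  + 2 * R + + 2 * (X - + n₁ * Bₖ)
    ≡⟨ cong (_+ + 2 * (X - + n₁ * Bₖ)) (sumRange-id a n₁) ⟩
  + n₁ * (+ 2 * a + + n₁ - + 1) + + 2 * (X - + n₁ * Bₖ)
    ≡⟨ collect a X (+ n₁) Bₖ ⟩
  + 2 * X + (+ 2 * a - + 1 - + 2 * Bₖ) * + n₁ + + n₁ * + n₁
    ≡⟨ cong (λ d → + 2 * X + (+ 2 * a - + 1 - + 2 * Bₖ) * d + d * d) (sym F-a≡n₁) ⟩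
  + 2 * X + (+ 2 * a - + 1 - + 2 * Bₖ) * (f (fromℕ k) - a)
    + (f (fromℕ k) - a) * (f (fromℕ k) - a)
    ≡⟨ cong (_+ (f (fromℕ k) - a) * (f (fromℕ k) - a))
            (sym (sumFin-chainWeight a k B (λ j → f j - a))) ⟩
  sumFin (λ j → chainWeight a (suc k) B j * (f j - a)) + lastSq (suc k) (λ j → f j - a) ∎
  where
  open ≡-Reasoning
  A : ℤ → ℤ
  A = chainAge (suc k) B f
  Bₖ R X : ℤ
  Bₖ = B (inject₁ (fromℕ k))
  R = sumRange a n₁ (λ t → t)
  X = sumFin (λ j → (B (suc (inject₁ j)) - B (inject₁ (inject₁ j))) * (f (inject₁ j) - a))
  expand : ∀ R X n Bₖ → + 2 * ((R - (n * Bₖ - X)) + + 0) ≡ + 2 * R + + 2 * (X - n * Bₖ)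
  expand = solve-∀
  collect : ∀ a X n Bₖ → n * (+ 2 * a + n - + 1) + + 2 * (X - n * Bₖ)
                         ≡ + 2 * X + (+ 2 * a - + 1 - + 2 * Bₖ) * n + n * n
  collect = solve-∀
  F-a≡n₁ : f (fromℕ k) - a ≡ + n₁
  F-a≡n₁ = trans (cong (_- a) F≡a+n₁) (i+j-i≡j a (+ n₁))
  before : sumRange a n₁ A ≡ R - (+ n₁ * Bₖ - X)
  before = begin
    sumRange a n₁ A
      ≡⟨ sumRange-cong a n₁ (λ t _ t<a+n₁ →
           chainAge-< k B f (subst (t <_) (sym F≡a+n₁) t<a+n₁)) ⟩
    sumRange a n₁ (λ t → t - B (inject₁ (lastLe k (f ∘ inject₁) t)))
      ≡⟨ sumRange-distrib-- a n₁ (λ t → t) _ ⟩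
    R - sumRange a n₁ (λ t → B (inject₁ (lastLe k (f ∘ inject₁) t)))
      ≡⟨ cong (_-_ R) (sumRange-lastLe a n₁ k (f ∘ inject₁) (B ∘ inject₁)
                         (Increasing-inject₁ inc) (lo ∘ inject₁) (Increasing⇒init≤last k inc F≡a+n₁)) ⟩
    R - (+ n₁ * Bₖ - X) ∎
  after : sumRange (a + + n₁) n₂ A ≡ + 0
  after = trans (sumRange-cong (a + + n₁) n₂ λ t a+n₁≤t _ →
                   chainAge-≥ k B f (subst (_≤ t) (sym F≡a+n₁) a+n₁≤t))
                (trans (sumRange-const (a + + n₁) n₂ (+ 0)) (ℤ.*-zeroʳ (+ n₂)))

module _ (I : AgeInstance) where
  open AgeInstance I

  age≡chainAge : ∀ S i t → age I S i t ≡ chainAge (m i) (+_ ∘ b i) (λ j → S (i , j)) t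
  age≡chainAge S i t with toℕ (lm I S i t) ℕ.≟ m i
  ... | yes _ = refl
  ... | no  _ = refl

  corrWeight≡chainWeight : ∀ i j → corrWeight I i j ≡ chainWeight (+ T0) (m i) (+_ ∘ b i) j
  corrWeight≡chainWeight i j with suc (toℕ j) ℕ.<? m i
  ... | yes _ = refl
  ... | no  _ = refl

  twice-Age≡wcs : (Sage : Msg I → ℤ) (Sjob : Job (corr I) → ℤ)
    → (∀ i j → Sage (i , j) ≡ Sjob (i , j) + + T0)
    → FeasibleAge I Sage → + 2 * Age I Sage ≡ wcs (corr I) Sjob
  twice-Age≡wcs Sage Sjob Sage≡ (bounds , _ , _ , increasing) = begin
    + 2 * Age I Sage
      ≡⟨ *-distribˡ-sumFin (+ 2) (λ i → sumFromTo (+ T0) (Tage I) (age I Sage i)) ⟩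
    sumFin (λ i → + 2 * sumFromTo (+ T0) (Tage I) (age I Sage i))
      ≡⟨ sumFin-cong twice-chain ⟩
    sumFin (λ i → Weighted i + LastSq i)
      ≡⟨ sumFin-distrib-+ Weighted LastSq ⟩
    wcs (corr I) Sjob ∎
    where
    open ≡-Reasoning
    Weighted LastSq : Fin n → ℤ
    Weighted i = sumFin (λ j → corrWeight I i j * Sjob (i , j))
    LastSq   i = lastSq (m i) (λ j → Sjob (i , j))
    Sage-T0≡Sjob : ∀ i j → Sage (i , j) - + T0 ≡ Sjob (i , j)
    Sage-T0≡Sjob i j = trans (cong (_- + T0) (Sage≡ i j)) (i+j-j≡i _ (+ T0))
    twice-chain : ∀ i → + 2 * sumFromTo (+ T0) (Tage I) (age I Sage i) ≡ Weighted i + LastSq i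
    twice-chain i = begin
      + 2 * sumFromTo (+ T0) (Tage I) (age I Sage i)
        ≡⟨ cong (+ 2 *_) (sumFromTo-cong (+ T0) (Tage I) (age≡chainAge Sage i)) ⟩
      + 2 * sumFromTo (+ T0) (Tage I) (chainAge (m i) (+_ ∘ b i) (λ j → Sage (i , j)))
        ≡⟨ sumFromTo-chainAge (+ T0) (Tage I) (m i) (+_ ∘ b i) (λ j → Sage (i , j)) (increasing i)
             (λ j → ℤ.≤-trans (ℤ.i≤i+j (+ T0) (+ 1)) (proj₁ (bounds (i , j))))
             (λ j → proj₂ (bounds (i , j))) ⟩
      sumFin (λ j → chainWeight (+ T0) (m i) (+_ ∘ b i) j * (Sage (i , j) - + T0))
        + lastSq (m i) (λ j → Sage (i , j) - + T0)
        ≡⟨ cong₂ _+_ (sumFin-cong λ j →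
                        cong₂ _*_ (sym (corrWeight≡chainWeight i j)) (Sage-T0≡Sjob i j))
                     (lastSq-cong (m i) (Sage-T0≡Sjob i)) ⟩
      Weighted i + LastSq i ∎

lemma1 : (I : AgeInstance) (Sage : Msg I → ℤ) (Sjob : Job (corr I) → ℤ)
    → (∀ i j → Sage (i , j) ≡ Sjob (i , j) + + AgeInstance.T0 I)
    → (FeasibleAge I Sage ⇔ FeasibleJob (corr I) Sjob)
      × (FeasibleAge I Sage → + 2 * Age I Sage ≡ wcs (corr I) Sjob)
lemma1 I Sage Sjob Sage≡ =
  mk⇔ (Feasible-shift (- c) Sjob≡ (sym (i+j-i≡j c (+ 1))) (sym (i+j-i≡j c (+ Tage I)))
                      (λ inc i → Increasing-shift (- c) (λ j → Sjob≡ (i , j)) (inc i)))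
      (Feasible-shift c (λ (i , j) → Sage≡ i j) (ℤ.+-comm c (+ 1)) (ℤ.+-comm c (+ Tage I))
                      (λ inc i → Increasing-shift c (Sage≡ i) (inc i)))
  , twice-Age≡wcs I Sage Sjob Sage≡
  where
  c : ℤ
  c = + AgeInstance.T0 I
  Sjob≡ : ∀ x → Sjob x ≡ Sage x - c
  Sjob≡ (i , j) = sym (trans (cong (_- c) (Sage≡ i j)) (i+j-j≡i _ c))
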